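{- Let $G$ be an input tree and $G\Rightarrow_{\{r_0,r_1,r_2\}}^*H$. Then either $|V_H|=1$ or $H$ is not in normal form (i.e. some rule of $\{r_0,r_1,r_2\}$ is applicable to $H$).
   Context: Label alphabet $\mathcal{L}=(\{\square,\triangle\},\{\square\})$. A graph is $G=(V,E,s,t,l,m,p)$ with finite $V,E$, total $s,t:E\to V$, partial node labelling into $\{\square,\triangle\}$, total edge labelling into $\{\square\}$, partial rootedness $p:V\to\{0,1\}$ ($1$: root). A TLRG has $l,p$ total. Morphisms preserve sources, targets, edge labels, node labels and rootedness where defined in the domain. A rule $\langle L\leftarrow K\rightarrow R\rangle$: TLRGs $L,R$ and a graph $K$ that is a subgraph of both. Application to a TLRG $G$ via injective $g:L\to G$ satisfying the dangling condition (no edge outside $g(L)$ incident to $g(V_L\setminus V_K)$): delete images of $L\setminus K$; make $g_V(v)$ unlabelled / of undefined rootedness when $v\in V_K$ is so in $K$; add disjointly $R\setminus K$; give such $g_V(v)$ label $l_R(v)$ / rootedness $p_R(v)$. Rules (all edges labelled $\square$): $r_0$: $L$ = unrooted node 1 labelled $\square$ with an edge to rooted node 2 labelled $\square$; $K$ = node 1 unlabelled, undefined rootedness; $R$ = node 1 rooted labelled $\square$. $r_1$: as $r_0$ but node 1 in $L$ labelled $\triangle$. $r_2$: $L$ = rooted node 1 labelled $\square$ with edge to unrooted node 2 labelled $\square$; $K$ = nodes 1,2 unlabelled, undefined rootedness, no edges; $R$ = unrooted node 1 labelled $\triangle$ with edge to rooted node 2 labelled $\square$. An input tree is a TLRG with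 exactly one root node, all nodes and edges labelled $\square$, which is a tree: non-empty, underlying undirected multigraph connected with no cycles (no loops or parallel edges), every node with at most one incoming edge. -}

module Defs where

open import Data.Nat using (ℕ; zero; suc; _≤_)
open import Data.Fin using (Fin; zero; suc)
open import Data.Fin.Properties using (any?) renaming (_≟_ to _≟ᶠ_)
open import Data.Bool using (Bool; true; false)
open import Data.Maybe using (Maybe; just; nothing; Is-just)
open import Data.Product using (Σ; ∃; _×_; _,_; proj₁; proj₂)
open import Data.Sum using (_⊎_; inj₁; inj₂)
open import Data.List using (List; []; _∷_)
open import Data.List.Relation.Unary.Unique.Propositional using (Unique)
open import Data.Empty using (⊥; ⊥-elim)
open import Function using (_∘_)
open import Function.Bundles using (_↔_; Inverse)
open import Function.Definitions using (Injective)
open import Relation.Nullary using (¬_; Dec; yes; no)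
open import Relation.Nullary.Decidable using (False; toWitnessFalse; fromWitnessFalse; ¬?; _×-dec_)
open import Relation.Binary.PropositionalEquality using (_≡_; _≢_; refl; sym; trans; cong)
open import Relation.Binary.Construct.Closure.ReflexiveTransitive using (Star)

data NodeLabel : Set where
  □ △ : NodeLabel

data EdgeLabel : Set where
  □ᴱ : EdgeLabel

-- Graphs: finite node set Fin nV, finite edge set Fin nE,
-- total source/target, partial node labelling (Maybe), total edge
-- labelling, partial rootedness (Maybe Bool; true = root).

record Graph : Set where
  field
    nV nE : ℕ
    src tgt : Fin nE → Fin nV
    lab  : Fin nV → Maybe NodeLabel
    elab : Fin nE → EdgeLabel
    root : Fin nV → Maybe Bool
open Graph public

TLRG : Graph → Set
TLRG G = (∀ v → Is-just (lab G v)) × (∀ v → Is-just (root G v))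

-- Rules  ⟨ L ← K → R ⟩.  K is given by its own node/edge sets with
-- inclusions into L and R (K is a subgraph of both).

record Rule : Set where
  field
    L R : Graph
    kV kE : ℕ
    Ksrc Ktgt : Fin kE → Fin kV
    Klab  : Fin kV → Maybe NodeLabel
    Kroot : Fin kV → Maybe Bool
    iLV : Fin kV → Fin (nV L)
    iLE : Fin kE → Fin (nE L)
    iRV : Fin kV → Fin (nV R)
    iRE : Fin kE → Fin (nE R)
    iL-src : ∀ k → src L (iLE k) ≡ iLV (Ksrc k)
    iL-tgt : ∀ k → tgt L (iLE k) ≡ iLV (Ktgt k)
    iR-src : ∀ k → src R (iRE k) ≡ iRV (Ksrc k)
    iR-tgt : ∀ k → tgt R (iRE k) ≡ iRV (Ktgt k)
open Rule public

record Morphism (A B : Graph) : Set where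
  field
    fV : Fin (nV A) → Fin (nV B)
    fE : Fin (nE A) → Fin (nE B)
    f-src  : ∀ e → src B (fE e) ≡ fV (src A e)
    f-tgt  : ∀ e → tgt B (fE e) ≡ fV (tgt A e)
    f-elab : ∀ e → elab B (fE e) ≡ elab A e
    f-lab  : ∀ v l → lab A v ≡ just l → lab B (fV v) ≡ just l
    f-root : ∀ v b → root A v ≡ just b → root B (fV v) ≡ just b
open Morphism public

record Match (r : Rule) (G : Graph) : Set where
  field
    g : Morphism (L r) G
    injV : Injective _≡_ _≡_ (fV g)
    injE : Injective _≡_ _≡_ (fE g)
    dangling : ∀ (e : Fin (nE G)) (u : Fin (nV (L r))) →
               (¬ ∃ λ k → iLV r k ≡ u) →
               (src G e ≡ fV g u ⊎ tgt G e ≡ fV g u) →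
               ∃ λ e′ → fE g e′ ≡ e
open Match public

Applicable : Rule → Graph → Set
Applicable r G = Match r G

-- The result of applying r at match m (carriers are types; the
-- result graph is then required to be isomorphic to it).

module Result (r : Rule) (G : Graph) (m : Match r G) where
  private
    gV = fV (g m)
    gE = fE (g m)

  delV? : (v : Fin (nV G)) → Dec (∃ λ u → (¬ ∃ λ k → iLV r k ≡ u) × gV u ≡ v)
  delV? v = any? (λ u → ¬? (any? (λ k → iLV r k ≟ᶠ u)) ×-dec (gV u ≟ᶠ v))

  delE? : (e : Fin (nE G)) → Dec (∃ λ u → (¬ ∃ λ k → iLE r k ≡ u) × gE u ≡ e)
  delE? e = any? (λ u → ¬? (any? (λ k → iLE r k ≟ᶠ u)) ×-dec (gE u ≟ᶠ e))

  inKV? : (w : Fin (nV (R r))) → Dec (∃ λ k → iRV r k ≡ w)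
  inKV? w = any? (λ k → iRV r k ≟ᶠ w)

  inKE? : (w : Fin (nE (R r))) → Dec (∃ λ k → iRE r k ≡ w)
  inKE? w = any? (λ k → iRE r k ≟ᶠ w)

  inKG? : (v : Fin (nV G)) → Dec (∃ λ k → gV (iLV r k) ≡ v)
  inKG? v = any? (λ k → gV (iLV r k) ≟ᶠ v)

  VD : Set
  VD = (Σ (Fin (nV G)) (λ v → False (delV? v))) ⊎ (Σ (Fin (nV (R r))) (λ w → False (inKV? w)))

  ED : Set
  ED = (Σ (Fin (nE G)) (λ e → False (delE? e))) ⊎ (Σ (Fin (nE (R r))) (λ w → False (inKE? w)))

  keptK : ∀ k → ¬ ∃ λ u → (¬ ∃ λ k′ → iLV r k′ ≡ u) × gV u ≡ gV (iLV r k)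
  keptK k (u , nk , eq) = nk (k , sym (injV m eq))

  keptEnd : ∀ e (w : Fin (nV G)) → (src G e ≡ w ⊎ tgt G e ≡ w) → False (delE? e) →
            ¬ ∃ λ u → (¬ ∃ λ k → iLV r k ≡ u) × gV u ≡ w
  keptEnd e w st ke (u , nk , eq) with dangling m e u nk (Data.Sum.map (λ p → trans p (sym eq)) (λ p → trans p (sym eq)) st)
  ... | e′ , ge′ with any? (λ k → iLE r k ≟ᶠ e′)
  ...   | no ¬k = toWitnessFalse ke (e′ , ¬k , ge′)
  ...   | yes (k , ik) with st
  ...     | inj₁ p = nk (Ksrc r k , sym (injV m (trans eq (sym (trans (cong gV (trans (sym (iL-src r k)) (cong (src (L r)) ik))) (trans (sym (f-src (g m) e′)) (trans (cong (src G) ge′) p)))))))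
  ...     | inj₂ p = nk (Ktgt r k , sym (injV m (trans eq (sym (trans (cong gV (trans (sym (iL-tgt r k)) (cong (tgt (L r)) ik))) (trans (sym (f-tgt (g m) e′)) (trans (cong (tgt G) ge′) p)))))))

  fromR : Fin (nV (R r)) → VD
  fromR w with inKV? w
  ... | yes (k , _) = inj₁ (gV (iLV r k) , fromWitnessFalse (keptK k))
  ... | no ¬k = inj₂ (w , fromWitnessFalse ¬k)

  srcD : ED → VD
  srcD (inj₁ (e , ke)) = inj₁ (src G e , fromWitnessFalse (keptEnd e (src G e) (inj₁ refl) ke))
  srcD (inj₂ (w , _))  = fromR (src (R r) w)

  tgtD : ED → VD
  tgtD (inj₁ (e , ke)) = inj₁ (tgt G e , fromWitnessFalse (keptEnd e (tgt G e) (inj₂ refl) ke))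
  tgtD (inj₂ (w , _))  = fromR (tgt (R r) w)

  elabD : ED → EdgeLabel
  elabD (inj₁ (e , _)) = elab G e
  elabD (inj₂ (w , _)) = elab (R r) w

  labD : VD → Maybe NodeLabel
  labD (inj₁ (v , _)) with inKG? v
  ... | yes (k , _) with Klab r k
  ...   | nothing = lab (R r) (iRV r k)
  ...   | just _  = lab G v
  labD (inj₁ (v , _)) | no _ = lab G v
  labD (inj₂ (w , _)) = lab (R r) w

  rootD : VD → Maybe Bool
  rootD (inj₁ (v , _)) with inKG? v
  ... | yes (k , _) with Kroot r k
  ...   | nothing = root (R r) (iRV r k)
  ...   | just _  = root G v
  rootD (inj₁ (v , _)) | no _ = root G v
  rootD (inj₂ (w , _)) = root (R r) w

  record IsResult (H : Graph) : Set where
    field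
      φV : VD ↔ Fin (nV H)
      φE : ED ↔ Fin (nE H)
      φ-src  : ∀ e → src H (Inverse.to φE e) ≡ Inverse.to φV (srcD e)
      φ-tgt  : ∀ e → tgt H (Inverse.to φE e) ≡ Inverse.to φV (tgtD e)
      φ-elab : ∀ e → elab H (Inverse.to φE e) ≡ elabD e
      φ-lab  : ∀ v → lab H (Inverse.to φV v) ≡ labD v
      φ-root : ∀ v → root H (Inverse.to φV v) ≡ rootD v

_⇒[_]_ : Graph → Rule → Graph → Set
G ⇒[ r ] H = TLRG G × Σ (Match r G) (λ m → Result.IsResult r G m H)

-- The rules r₀, r₁, r₂ (node 1 = zero, node 2 = suc zero)

private
  e2 : Fin 1 → Fin 2
  e2 _ = zero
  e2′ : Fin 1 → Fin 2
  e2′ _ = suc zero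

  lab2 : NodeLabel → NodeLabel → Fin 2 → Maybe NodeLabel
  lab2 a b zero = just a
  lab2 a b (suc _) = just b

  root2 : Bool → Bool → Fin 2 → Maybe Bool
  root2 a b zero = just a
  root2 a b (suc _) = just b

  edgeGraph : NodeLabel → Bool → NodeLabel → Bool → Graph
  edgeGraph l1 p1 l2 p2 = record
    { nV = 2 ; nE = 1 ; src = e2 ; tgt = e2′
    ; lab = lab2 l1 l2 ; elab = λ _ → □ᴱ ; root = root2 p1 p2 }

  rootNode : Graph
  rootNode = record
    { nV = 1 ; nE = 0 ; src = λ () ; tgt = λ ()
    ; lab = λ _ → just □ ; elab = λ () ; root = λ _ → just true }

  noE : ∀ {A : Set} → Fin 0 → A
  noE ()

  rule01 : NodeLabel → Rule
  rule01 l = record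
    { L = edgeGraph l false □ true ; R = rootNode
    ; kV = 1 ; kE = 0 ; Ksrc = noE ; Ktgt = noE
    ; Klab = λ _ → nothing ; Kroot = λ _ → nothing
    ; iLV = λ _ → zero ; iLE = noE ; iRV = λ _ → zero ; iRE = noE
    ; iL-src = λ () ; iL-tgt = λ () ; iR-src = λ () ; iR-tgt = λ () }

r₀ : Rule
r₀ = rule01 □

r₁ : Rule
r₁ = rule01 △

r₂ : Rule
r₂ = record
  { L = edgeGraph □ true □ false ; R = edgeGraph △ false □ true
  ; kV = 2 ; kE = 0 ; Ksrc = λ () ; Ktgt = λ ()
  ; Klab = λ _ → nothing ; Kroot = λ _ → nothing
  ; iLV = λ k → k ; iLE = λ () ; iRV = λ k → k ; iRE = λ ()
  ; iL-src = λ () ; iL-tgt = λ () ; iR-src = λ () ; iR-tgt = λ () }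

data InRules : Rule → Set where
  in-r₀ : InRules r₀
  in-r₁ : InRules r₁
  in-r₂ : InRules r₂

_⇒_ : Graph → Graph → Set
G ⇒ H = Σ Rule (λ r → InRules r × G ⇒[ r ] H)

_⇒*_ : Graph → Graph → Set
_⇒*_ = Star _⇒_

-- undirected walks: an edge may be traversed forwards (true) or backwards
module _ (G : Graph) where
  start end : Fin (nE G) × Bool → Fin (nV G)
  start (e , true)  = src G e
  start (e , false) = tgt G e
  end   (e , true)  = tgt G e
  end   (e , false) = src G e

  data Walk : Fin (nV G) → Fin (nV G) → Set where
    []  : ∀ {v} → Walk v v
    _∷_ : ∀ {w} (d : Fin (nE G) × Bool) → Walk (end d) w → Walk (start d) w

  walkEdges : ∀ {u w} → Walk u w → List (Fin (nE G))
  walkEdges [] = []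
  walkEdges (d ∷ p) = proj₁ d ∷ walkEdges p

  -- nodes visited, excluding the final one
  walkNodes : ∀ {u w} → Walk u w → List (Fin (nV G))
  walkNodes [] = []
  walkNodes {u} (d ∷ p) = u ∷ walkNodes p

  -- a cycle in the underlying undirected multigraph (loops and pairs of
  -- parallel edges are cycles of length 1 and 2)
  IsCycle : ∀ {v} → Walk v v → Set
  IsCycle [] = ⊥
  IsCycle p@(_ ∷ _) = Unique (walkEdges p) × Unique (walkNodes p)

  IsTree : Set
  IsTree = (1 ≤ nV G)
         × (∀ u v → Walk u v)
         × (∀ v (p : Walk v v) → ¬ IsCycle p)
         × (∀ e e′ → tgt G e ≡ tgt G e′ → e ≡ e′)

InputTree : Graph → Set
InputTree G = TLRG G
            × (∃ λ ρ → root G ρ ≡ just true × ∀ v → root G v ≡ just true → v ≡ ρ)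
            × (∀ v → lab G v ≡ just □)
            × (∀ e → elab G e ≡ □ᴱ)
            × IsTree G

module Submission where

open import Defs
open import Data.Sum using (_⊎_; inj₁; inj₂)
open import Data.Product using (Σ; _×_; _,_; ∃; proj₁; proj₂)
open import Relation.Binary.PropositionalEquality using (_≡_; _≢_; refl; sym; trans; cong; subst; subst₂)
open import Data.Nat using (ℕ; zero; suc; _<_; _≤_; _+_; s≤s; z≤n)
open import Data.Nat.Properties using (≤-refl; +-suc; +-identityʳ; <⇒≱)
open import Data.Nat.Induction using (<-wellFounded)
open import Data.Fin using (Fin; zero; suc)
open import Data.Fin.Properties using (any?; injective⇒≤) renaming (_≟_ to _≟ᶠ_)
open import Data.Maybe using (Maybe; just; nothing; Is-just)
import Data.Maybe.Relation.Unary.Any as MaybeAny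
open import Data.Empty using (⊥; ⊥-elim)
open import Data.Unit using (⊤; tt)
open import Data.Bool using (true; false)
open import Data.Bool.Properties using (T-irrelevant)
open import Data.List using (List; []; _∷_; _++_; map; length; lookup)
open import Data.List.Relation.Unary.All using (All; []; _∷_)
import Data.List.Relation.Unary.All as All
import Data.List.Relation.Unary.All.Properties as All
open import Data.List.Relation.Unary.AllPairs using ([]; _∷_)
open import Data.List.Relation.Unary.Any using (here; there)
open import Data.List.Relation.Unary.Unique.Propositional using (Unique)
import Data.List.Relation.Unary.Unique.Propositional.Properties as Unique
open import Data.List.Membership.Propositional using (_∈_; _∉_)
open import Data.List.Membership.Propositional.Properties using (∈-lookup)
open import Relation.Nullary using (¬_; yes; no)
open import Relation.Nullary.Decidable using (False; toWitnessFalse; fromWitnessFalse; decidable-stable)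
open import Function using (_∘_; _on_)
open import Function.Bundles using (Inverse; _↔_)
open import Function.Definitions using (Injective)
open import Induction.WellFounded using (Acc; acc; acc⇒asym; module Subrelation)
import Relation.Binary.Construct.On as On
open import Relation.Binary.Construct.Closure.Transitive using (TransClosure; [_]; _∷ʳ_)
import Relation.Binary.Construct.Closure.Transitive as Transitive
open import Relation.Binary.Construct.Closure.ReflexiveTransitive using (Star; ε; _◅_)

-- Proof: we find an invariant of derivable graphs.  Each one is a totally
-- labelled arborescence (in-degree ≤ 1, well-founded ancestors, one source)
-- with a unique root ρ labelled □, whose △-nodes (former roots) descend by
-- rank-decreasing edges to ρ.

Is-just⇒≡just : ∀ {A : Set} {x : Maybe A} → Is-just x → ∃ λ a → x ≡ just a
Is-just⇒≡just (MaybeAny.just _) = _ , refl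

≡just⇒Is-just : ∀ {A : Set} {x : Maybe A} {a : A} → x ≡ just a → Is-just x
≡just⇒Is-just refl = MaybeAny.just tt

□≢△ : _≢_ {A = Maybe NodeLabel} (just □) (just △)
□≢△ ()

-- the edge alphabet has a single letter, so edge labels are preserved by any map
edge-label : (x : EdgeLabel) → x ≡ □ᴱ
edge-label □ᴱ = refl

Parent : (H : Graph) → Fin (nV H) → Fin (nV H) → Set
Parent H y x = ∃ λ e → src H e ≡ y × tgt H e ≡ x

Ancestor : (H : Graph) → Fin (nV H) → Fin (nV H) → Set
Ancestor H = TransClosure (Parent H)

IsSource : (H : Graph) → Fin (nV H) → Set
IsSource H v = ∀ e → tgt H e ≢ v

acc⇒noCycle : ∀ H {x} → Acc (Parent H) x → ¬ Ancestor H x x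
acc⇒noCycle H a p = acc⇒asym (Transitive.accessible (Parent H) a) p p

record Arborescence (H : Graph) : Set where
  field
    in≤1 : ∀ e e′ → tgt H e ≡ tgt H e′ → e ≡ e′
    acyclic : ∀ v → Acc (Parent H) v
    uniqueSource : ∀ u v → IsSource H u → IsSource H v → u ≡ v

module ArborescenceProperties {H : Graph} (A : Arborescence H) where
  open Arborescence A

  noLoop : ∀ e → src H e ≢ tgt H e
  noLoop e eq = acc⇒noCycle H (acyclic (src H e)) [ e , refl , sym eq ]

  -- a source without outgoing edges is the only node: every other node
  -- has a source above it, which would have to be ρ
  isolated⇒only : ∀ ρ → IsSource H ρ → (∀ e → src H e ≢ ρ) → ∀ v → v ≡ ρ
  isolated⇒only ρ ρ-source ρ-leaf v = climb v (acyclic v)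
    where
    climb : ∀ v → Acc (Parent H) v → v ≡ ρ
    climb v (acc rs) with any? (λ e → tgt H e ≟ᶠ v)
    ... | yes (e , te) = ⊥-elim (ρ-leaf e (climb (src H e) (rs (e , refl , te))))
    ... | no ¬in = uniqueSource v ρ (λ e te → ¬in (e , te)) ρ-source

△OrRoot : (H : Graph) → Fin (nV H) → Fin (nV H) → Set
△OrRoot H ρ w = lab H w ≡ just △ ⊎ w ≡ ρ

record Invariant (H : Graph) : Set where
  field
    total : TLRG H
    ρ : Fin (nV H)
    ρ-root : root H ρ ≡ just true
    ρ-unique : ∀ v → root H v ≡ just true → v ≡ ρ
    ρ-label : lab H ρ ≡ just □
    arborescence : Arborescence H
    rank : Fin (nV H) → ℕ
    descent : ∀ v → lab H v ≡ just △ →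
              ∃ λ e → src H e ≡ v × △OrRoot H ρ (tgt H e) × rank (tgt H e) < rank v

module InvariantProperties {H : Graph} (I : Invariant H) where
  open Invariant I
  open Arborescence arborescence
  open ArborescenceProperties arborescence public

  labelOf : ∀ v → ∃ λ l → lab H v ≡ just l
  labelOf v = Is-just⇒≡just (proj₁ total v)

  nonRoot : ∀ v → v ≢ ρ → root H v ≡ just false
  nonRoot v v≢ρ with Is-just⇒≡just (proj₂ total v)
  ... | false , eq = eq
  ... | true , eq = ⊥-elim (v≢ρ (ρ-unique v eq))

  -- following descent edges from a child of ρ would lead back to ρ
  child-of-root-□ : ∀ e → src H e ≡ ρ → lab H (tgt H e) ≢ just △
  child-of-root-□ e se l = descend (tgt H e) (<-wellFounded _) (inj₁ l) [ e , se , refl ]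
    where
    descend : ∀ v → Acc _<_ (rank v) → △OrRoot H ρ v → Ancestor H ρ v → ⊥
    descend v _ (inj₂ refl) anc = acc⇒noCycle H (acyclic ρ) anc
    descend v (acc rs) (inj₁ l) anc with descent v l
    ... | e , se , next , lt = descend (tgt H e) (rs lt) next (anc ∷ʳ (e , se , refl))

all≡⇒singleton : ∀ n (ρ : Fin n) → (∀ v → v ≡ ρ) → n ≡ 1
all≡⇒singleton (suc zero) ρ all≡ρ = refl
all≡⇒singleton (suc (suc n)) ρ all≡ρ with trans (all≡ρ zero) (sym (all≡ρ (suc zero)))
... | ()

pair : ∀ {n} → Fin n → Fin n → Fin 2 → Fin n
pair a b zero = a
pair a b (suc _) = b

pair-injective : ∀ {n} {a b : Fin n} → a ≢ b → Injective _≡_ _≡_ (pair a b)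
pair-injective a≢b {zero} {zero} _ = refl
pair-injective a≢b {zero} {suc zero} eq = ⊥-elim (a≢b eq)
pair-injective a≢b {suc zero} {zero} eq = ⊥-elim (a≢b (sym eq))
pair-injective a≢b {suc zero} {suc zero} _ = refl

single-injective : ∀ {A : Set} {a : A} → Injective _≡_ _≡_ (λ (_ : Fin 1) → a)
single-injective {x = zero} {y = zero} _ = refl

-- A graph satisfying the invariant either has a single node or admits a
-- match: r₂ along an out-edge of the root, otherwise r₀/r₁ along its in-edge.
module NormalForm {H : Graph} (I : Invariant H) where
  open Invariant I
  open InvariantProperties I

  shift-match : ∀ e → src H e ≡ ρ → Match r₂ H
  shift-match e se = record
    { g = record { fV = pair ρ c ; fE = λ _ → e ; f-src = λ _ → se ; f-tgt = λ _ → refl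
                 ; f-elab = λ _ → edge-label _ ; f-lab = on-labels ; f-root = on-roots }
    ; injV = pair-injective ρ≢c ; injE = single-injective
    ; dangling = λ _ u u∉K _ → ⊥-elim (u∉K (u , refl)) }
    where
    c : Fin (nV H)
    c = tgt H e
    ρ≢c : ρ ≢ c
    ρ≢c eq = noLoop e (trans se eq)
    c-label : lab H c ≡ just □
    c-label with labelOf c
    ... | □ , eq = eq
    ... | △ , eq = ⊥-elim (child-of-root-□ e se eq)
    on-labels : ∀ v l → lab (L r₂) v ≡ just l → lab H (pair ρ c v) ≡ just l
    on-labels zero .□ refl = ρ-label
    on-labels (suc zero) .□ refl = c-label
    on-roots : ∀ v b → root (L r₂) v ≡ just b → root H (pair ρ c v) ≡ just b
    on-roots zero .true refl = ρ-root
    on-roots (suc zero) .false refl = nonRoot c (ρ≢c ∘ sym)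

  module ContractionMatch (e : Fin (nE H)) (te : tgt H e ≡ ρ) (ρ-leaf : ∀ e → src H e ≢ ρ) where
    p : Fin (nV H)
    p = src H e

    p≢ρ : p ≢ ρ
    p≢ρ eq = noLoop e (trans eq (sym te))

    -- the deleted node ρ is incident to e only
    dangling-ok : ∀ e′ (u : Fin 2) → ¬ (∃ λ (k : Fin 1) → zero ≡ u) →
                  (src H e′ ≡ pair p ρ u ⊎ tgt H e′ ≡ pair p ρ u) → ∃ λ (_ : Fin 1) → e ≡ e′
    dangling-ok e′ zero u∉K _ = ⊥-elim (u∉K (zero , refl))
    dangling-ok e′ (suc zero) u∉K (inj₁ se′) = ⊥-elim (ρ-leaf e′ se′)
    dangling-ok e′ (suc zero) u∉K (inj₂ te′) = zero , in≤1 e e′ (trans te (sym te′))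
      where open Arborescence arborescence

    -- r₀ and r₁ share their rootedness pattern
    on-roots : ∀ v b → root (L r₀) v ≡ just b → root H (pair p ρ v) ≡ just b
    on-roots zero .false refl = nonRoot p p≢ρ
    on-roots (suc zero) .true refl = ρ-root

    match₀ : lab H p ≡ just □ → Match r₀ H
    match₀ p-label = record
      { g = record { fV = pair p ρ ; fE = λ _ → e ; f-src = λ _ → refl ; f-tgt = λ _ → te
                   ; f-elab = λ _ → edge-label _ ; f-lab = on-labels ; f-root = on-roots }
      ; injV = pair-injective p≢ρ ; injE = single-injective ; dangling = dangling-ok }
      where
      on-labels : ∀ v l → lab (L r₀) v ≡ just l → lab H (pair p ρ v) ≡ just l
      on-labels zero .□ refl = p-label
      on-labels (suc zero) .□ refl = ρ-label

    match₁ : lab H p ≡ just △ → Match r₁ H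
    match₁ p-label = record
      { g = record { fV = pair p ρ ; fE = λ _ → e ; f-src = λ _ → refl ; f-tgt = λ _ → te
                   ; f-elab = λ _ → edge-label _ ; f-lab = on-labels ; f-root = on-roots }
      ; injV = pair-injective p≢ρ ; injE = single-injective ; dangling = dangling-ok }
      where
      on-labels : ∀ v l → lab (L r₁) v ≡ just l → lab H (pair p ρ v) ≡ just l
      on-labels zero .△ refl = p-label
      on-labels (suc zero) .□ refl = ρ-label

  leaf-root : (∀ e → src H e ≢ ρ) → nV H ≡ 1 ⊎ Σ Rule (λ r → InRules r × Applicable r H)
  leaf-root ρ-leaf with any? (λ e → tgt H e ≟ᶠ ρ)
  ... | no no-in = inj₁ (all≡⇒singleton _ ρ (isolated⇒only ρ (λ e te → no-in (e , te)) ρ-leaf))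
  ... | yes (e , te) with labelOf (src H e)
  ...   | □ , l = inj₂ (r₀ , in-r₀ , ContractionMatch.match₀ e te ρ-leaf l)
  ...   | △ , l = inj₂ (r₁ , in-r₁ , ContractionMatch.match₁ e te ρ-leaf l)

  normalForm : nV H ≡ 1 ⊎ Σ Rule (λ r → InRules r × Applicable r H)
  normalForm with any? (λ e → src H e ≟ᶠ ρ)
  ... | yes (e , se) = inj₂ (r₂ , in-r₂ , shift-match e se)
  ... | no no-out = leaf-root (λ e se → no-out (e , se))

unique⇒length≤ : ∀ {n} (xs : List (Fin n)) → Unique xs → length xs ≤ n
unique⇒length≤ xs u = injective⇒≤ (lookup-injective u)
  where
  lookup-injective : ∀ {A : Set} {xs : List A} → Unique xs → ∀ {i j} → lookup xs i ≡ lookup xs j → i ≡ j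
  lookup-injective (x∉ ∷ u) {zero} {zero} _ = refl
  lookup-injective (x∉ ∷ u) {zero} {suc j} eq = ⊥-elim (All.lookup x∉ (∈-lookup j) eq)
  lookup-injective (x∉ ∷ u) {suc i} {zero} eq = ⊥-elim (All.lookup x∉ (∈-lookup i) (sym eq))
  lookup-injective (x∉ ∷ u) {suc i} {suc j} eq = cong suc (lookup-injective u eq)

unique-pull : ∀ {A : Set} (xs : List A) {y ys} → Unique (xs ++ y ∷ ys) → Unique (y ∷ xs)
unique-pull [] _ = [] ∷ []
unique-pull (x ∷ xs) {y} (x∉ ∷ u) with unique-pull xs u
... | y∉xs ∷ u-xs = (y≢x ∷ y∉xs) ∷ (All.++⁻ˡ xs x∉ ∷ u-xs)
  where
  y≢x : y ≢ x
  y≢x eq with All.++⁻ʳ xs x∉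
  ... | x≢y ∷ _ = x≢y (sym eq)

module TreeShape (G : Graph)
  (in≤1 : ∀ e e′ → tgt G e ≡ tgt G e′ → e ≡ e′)
  (no-cycle : ∀ v (p : Walk G v v) → ¬ IsCycle G p)
  (connected : ∀ u v → Walk G u v) where

  Forward : ∀ {a b} → Walk G a b → Set
  Forward [] = ⊤
  Forward ((e , true) ∷ W) = Forward W
  Forward ((e , false) ∷ W) = ⊥

  -- all nodes of a walk, including the last
  nodes : ∀ {a b} → Walk G a b → List (Fin (nV G))
  nodes {b = b} [] = b ∷ []
  nodes (d ∷ W) = start G d ∷ nodes W

  forward-nodes : ∀ {a b} (W : Walk G a b) → Forward W → walkNodes G W ≡ map (src G) (walkEdges G W)
  forward-nodes [] _ = refl
  forward-nodes ((e , true) ∷ W) f = cong (src G e ∷_) (forward-nodes W f)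

  split : ∀ {a b y} (W : Walk G a b) → Forward W → y ∈ nodes W →
          Σ (Walk G a y) λ W₁ → Forward W₁ × ∃ λ rest → nodes W ≡ walkNodes G W₁ ++ y ∷ rest
  split [] _ (here refl) = [] , tt , [] , refl
  split (d ∷ W) _ (here refl) = [] , tt , nodes W , refl
  split ((e , true) ∷ W) f (there y∈W) with split W f y∈W
  ... | W₁ , f₁ , rest , eq = (e , true) ∷ W₁ , f₁ , rest , cong (src G e ∷_) eq

  -- climbing from a duplicate-free forward walk never revisits a node:
  -- otherwise the edge e closes a cycle
  parent-is-new : ∀ {v} e (W : Walk G (tgt G e) v) → Forward W → Unique (nodes W) → src G e ∉ nodes W
  parent-is-new e W f u se∈W with split W f se∈W
  ... | W₁ , f₁ , rest , eq = no-cycle (src G e) C (edges-unique , nodes-unique)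
    where
    C : Walk G (src G e) (src G e)
    C = (e , true) ∷ W₁
    nodes-unique : Unique (walkNodes G C)
    nodes-unique = unique-pull (walkNodes G W₁) (subst Unique eq u)
    edges-unique : Unique (walkEdges G C)
    edges-unique = Unique.map⁻ (subst Unique (forward-nodes C f₁) nodes-unique)

  -- ancestors are well-founded: W records the climb so far; it stays
  -- duplicate-free, and the fuel runs out only if W had more than nV G nodes
  climb : ∀ {v} (fuel : ℕ) x (W : Walk G x v) → Forward W → Unique (nodes W) →
          nV G < length (nodes W) + fuel → Acc (Parent G) x
  climb zero x W f u bound =
    ⊥-elim (<⇒≱ bound (subst (_≤ nV G) (sym (+-identityʳ _)) (unique⇒length≤ _ u)))
  climb (suc fuel) x W f u bound = acc λ where
    (e , refl , refl) → climb fuel (src G e) ((e , true) ∷ W) f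
                              (All.¬Any⇒All¬ _ (parent-is-new e W f u) ∷ u)
                              (subst (nV G <_) (+-suc _ fuel) bound)

  acyclic : ∀ v → Acc (Parent G) v
  acyclic v = climb (nV G) v [] tt ([] ∷ []) ≤-refl

  Below : Fin (nV G) → Fin (nV G) → Set
  Below t y = Star (λ x z → Parent G z x) y t

  walk-below : ∀ {t a b} → IsSource G t → Walk G a b → Below t a → Below t b
  walk-below t-src [] below = below
  walk-below t-src ((e , true) ∷ W) below = walk-below t-src W ((e , refl , refl) ◅ below)
  walk-below t-src ((e , false) ∷ W) ε = ⊥-elim (t-src e refl)
  walk-below {t} t-src ((e , false) ∷ W) ((e′ , refl , te′) ◅ below) =
    walk-below t-src W (subst (λ z → Below t (src G z)) (in≤1 e′ e te′) below)

  uniqueSource : ∀ u v → IsSource G u → IsSource G v → u ≡ v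
  uniqueSource u v u-src v-src with walk-below u-src (connected u v) ε
  ... | ε = refl
  ... | (e , _ , te) ◅ _ = ⊥-elim (v-src e te)

inputTree⇒arborescence : ∀ G → IsTree G → Arborescence G
inputTree⇒arborescence G (_ , connected , no-cycle , in≤1) = record
  { in≤1 = in≤1 ; acyclic = TreeShape.acyclic G in≤1 no-cycle connected
  ; uniqueSource = TreeShape.uniqueSource G in≤1 no-cycle connected }

record Embedding (H G : Graph) : Set where
  field
    node : Fin (nV H) → Fin (nV G)
    edge : Fin (nE H) → Fin (nE G)
    edge-src : ∀ e → src G (edge e) ≡ node (src H e)
    edge-tgt : ∀ e → tgt G (edge e) ≡ node (tgt H e)
    node-injective : Injective _≡_ _≡_ node
    edge-injective : Injective _≡_ _≡_ edge
    in-edges-reflected : ∀ x e → tgt G e ≡ node x → ∃ λ e′ → tgt H e′ ≡ x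

reflect-arborescence : ∀ {H G} → Embedding H G → Arborescence G → Arborescence H
reflect-arborescence {H} {G} φ A = record
  { in≤1 = λ e e′ eq →
      edge-injective (in≤1 (edge e) (edge e′) (trans (edge-tgt e) (trans (cong node eq) (sym (edge-tgt e′)))))
  ; acyclic = λ x → Subrelation.accessible parent-preserved (On.accessible node (acyclic (node x)))
  ; uniqueSource = λ u v u-src v-src →
      node-injective (uniqueSource _ _ (source-preserved u u-src) (source-preserved v v-src)) }
  where
  open Embedding φ
  open Arborescence A
  parent-preserved : ∀ {y x} → Parent H y x → (Parent G on node) y x
  parent-preserved (e , se , te) = edge e , trans (edge-src e) (cong node se) , trans (edge-tgt e) (cong node te)
  source-preserved : ∀ x → IsSource H x → IsSource G (node x)
  source-preserved x x-src e te with in-edges-reflected x e te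
  ... | e′ , te′ = x-src e′ te′

from-injective : ∀ {A B : Set} (φ : A ↔ B) → Injective _≡_ _≡_ (Inverse.from φ)
from-injective φ {x} {y} eq =
  trans (sym (Inverse.strictlyInverseˡ φ x)) (trans (cong (Inverse.to φ) eq) (Inverse.strictlyInverseˡ φ y))

module Step (r : Rule) {G H : Graph} (m : Match r G) (iso : Result.IsResult r G m H) where
  open Result r G m public
  open Result.IsResult iso public

  Kept : Fin (nV G) → Set
  Kept v = False (delV? v)

  KeptEdge : Fin (nE G) → Set
  KeptEdge e = False (delE? e)

  kept : ∀ v → Kept v → Fin (nV H)
  kept v kv = Inverse.to φV (inj₁ (v , kv))

  keptEdge : ∀ e → KeptEdge e → Fin (nE H)
  keptEdge e ke = Inverse.to φE (inj₁ (e , ke))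

  kept-cong : ∀ {v w kv kw} → v ≡ w → kept v kv ≡ kept w kw
  kept-cong {v} {kv = kv} {kw} refl = cong (λ k → kept v k) (T-irrelevant kv kw)

  -- the dangling condition: kept edges have kept endpoints
  src-kept : ∀ e → KeptEdge e → Kept (src G e)
  src-kept e ke = fromWitnessFalse (keptEnd e (src G e) (inj₁ refl) ke)

  tgt-kept : ∀ e → KeptEdge e → Kept (tgt G e)
  tgt-kept e ke = fromWitnessFalse (keptEnd e (tgt G e) (inj₂ refl) ke)

  keptEdge-src : ∀ {v} e ke kv → src G e ≡ v → src H (keptEdge e ke) ≡ kept v kv
  keptEdge-src e ke kv se = trans (φ-src _) (kept-cong se)

  keptEdge-tgt : ∀ {v} e ke kv → tgt G e ≡ v → tgt H (keptEdge e ke) ≡ kept v kv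
  keptEdge-tgt e ke kv te = trans (φ-tgt _) (kept-cong te)

  deleted-edge : ∀ e → ¬ KeptEdge e → ∃ λ u → (¬ ∃ λ k → iLE r k ≡ u) × fE (g m) u ≡ e
  deleted-edge e ¬ke = decidable-stable (delE? e) (λ ¬deleted → ¬ke (fromWitnessFalse ¬deleted))

  relabelled : (∀ k → Klab r k ≡ nothing) → (∀ k → Kroot r k ≡ nothing) → ∀ v kv →
               (∃ λ k → fV (g m) (iLV r k) ≡ v × lab H (kept v kv) ≡ lab (R r) (iRV r k)
                                            × root H (kept v kv) ≡ root (R r) (iRV r k))
             ⊎ ((∀ k → fV (g m) (iLV r k) ≢ v) × lab H (kept v kv) ≡ lab G v × root H (kept v kv) ≡ root G v)
  relabelled unlabelled unrooted v kv
    with inKG? v | φ-lab (inj₁ (v , kv)) | φ-root (inj₁ (v , kv))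
  ... | yes (k , gk) | eq-lab | eq-root rewrite unlabelled k | unrooted k = inj₁ (k , gk , eq-lab , eq-root)
  ... | no ¬gk | eq-lab | eq-root = inj₂ ((λ k gk → ¬gk (k , gk)) , eq-lab , eq-root)

  newEdge : ∀ w → False (inKE? w) → Fin (nE H)
  newEdge w kw = Inverse.to φE (inj₂ (w , kw))

  every-edge : (P : Fin (nE H) → Set) → (∀ e ke → P (keptEdge e ke)) →
               (∀ w kw → P (newEdge w kw)) → ∀ y → P y
  every-edge P kept-case new-case y = subst P (Inverse.strictlyInverseˡ φE y) (by-cases (Inverse.from φE y))
    where
    by-cases : ∀ d → P (Inverse.to φE d)
    by-cases (inj₁ (e , ke)) = kept-case e ke
    by-cases (inj₂ (w , kw)) = new-case w kw

  module NoNewNodes (no-new : ∀ w → False (inKV? w) → ⊥) where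
    every-node : (P : Fin (nV H) → Set) → (∀ v kv → P (kept v kv)) → ∀ x → P x
    every-node P kept-case x = subst P (Inverse.strictlyInverseˡ φV x) (by-cases (Inverse.from φV x))
      where
      by-cases : ∀ d → P (Inverse.to φV d)
      by-cases (inj₁ (v , kv)) = kept-case v kv
      by-cases (inj₂ (w , kw)) = ⊥-elim (no-new w kw)

    originD : VD → Fin (nV G)
    originD (inj₁ (v , _)) = v
    originD (inj₂ (w , kw)) = ⊥-elim (no-new w kw)

    origin : Fin (nV H) → Fin (nV G)
    origin x = originD (Inverse.from φV x)

    origin-kept : ∀ v kv → origin (kept v kv) ≡ v
    origin-kept v kv = cong originD (Inverse.strictlyInverseʳ φV _)

    originD-injective : Injective _≡_ _≡_ originD
    originD-injective {inj₁ (v , kv)} {inj₁ (.v , kv′)} refl = cong (λ k → inj₁ (v , k)) (T-irrelevant kv kv′)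
    originD-injective {inj₁ _} {inj₂ (w , kw)} = ⊥-elim (no-new w kw)
    originD-injective {inj₂ (w , kw)} = ⊥-elim (no-new w kw)

    originD-kept : ∀ d → Kept (originD d)
    originD-kept (inj₁ (v , kv)) = kv
    originD-kept (inj₂ (w , kw)) = ⊥-elim (no-new w kw)

    origin-is-kept : ∀ x → Kept (origin x)
    origin-is-kept x = originD-kept (Inverse.from φV x)

    origin-injective : Injective _≡_ _≡_ origin
    origin-injective eq = from-injective φV (originD-injective eq)

    origin-src : ∀ e ke → origin (src H (keptEdge e ke)) ≡ src G e
    origin-src e ke = trans (cong origin (keptEdge-src e ke (src-kept e ke) refl)) (origin-kept _ _)

    origin-tgt : ∀ e ke → origin (tgt H (keptEdge e ke)) ≡ tgt G e
    origin-tgt e ke = trans (cong origin (keptEdge-tgt e ke (tgt-kept e ke) refl)) (origin-kept _ _)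

    total-preserved : (∀ k → Klab r k ≡ nothing) → (∀ k → Kroot r k ≡ nothing) →
                      TLRG (R r) → TLRG G → TLRG H
    total-preserved unlabelled unrooted (R-lab , R-root) (G-lab , G-root) =
      every-node _ lab-defined , every-node _ root-defined
      where
      lab-defined : ∀ v kv → Is-just (lab H (kept v kv))
      lab-defined v kv with relabelled unlabelled unrooted v kv
      ... | inj₁ (k , _ , eq , _) = subst Is-just (sym eq) (R-lab _)
      ... | inj₂ (_ , eq , _) = subst Is-just (sym eq) (G-lab v)
      root-defined : ∀ v kv → Is-just (root H (kept v kv))
      root-defined v kv with relabelled unlabelled unrooted v kv
      ... | inj₁ (k , _ , _ , eq) = subst Is-just (sym eq) (R-root _)
      ... | inj₂ (_ , _ , eq) = subst Is-just (sym eq) (G-root v)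

    module Replacing (old : ∀ w → False (inKE? w) → Fin (nE G))
             (old-src : ∀ w kw → src G (old w kw) ≡ origin (src H (newEdge w kw)))
             (old-tgt : ∀ w kw → tgt G (old w kw) ≡ origin (tgt H (newEdge w kw)))
             (old-deleted : ∀ w kw → ¬ KeptEdge (old w kw))
             (old-injective : ∀ w kw w′ kw′ → old w kw ≡ old w′ kw′ → w ≡ w′)
             (deleted-replaced : ∀ e x → ¬ KeptEdge e → tgt G e ≡ origin x → ∃ λ e′ → tgt H e′ ≡ x) where

      edgeOriginD : ED → Fin (nE G)
      edgeOriginD (inj₁ (e , _)) = e
      edgeOriginD (inj₂ (w , kw)) = old w kw

      edgeOrigin : Fin (nE H) → Fin (nE G)
      edgeOrigin y = edgeOriginD (Inverse.from φE y)

      edgeOrigin-kept : ∀ e ke → edgeOrigin (keptEdge e ke) ≡ e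
      edgeOrigin-kept e ke = cong edgeOriginD (Inverse.strictlyInverseʳ φE _)

      edgeOrigin-new : ∀ w kw → edgeOrigin (newEdge w kw) ≡ old w kw
      edgeOrigin-new w kw = cong edgeOriginD (Inverse.strictlyInverseʳ φE _)

      edgeOrigin-src : ∀ y → src G (edgeOrigin y) ≡ origin (src H y)
      edgeOrigin-src = every-edge _
        (λ e ke → trans (cong (src G) (edgeOrigin-kept e ke)) (sym (origin-src e ke)))
        (λ w kw → trans (cong (src G) (edgeOrigin-new w kw)) (old-src w kw))

      edgeOrigin-tgt : ∀ y → tgt G (edgeOrigin y) ≡ origin (tgt H y)
      edgeOrigin-tgt = every-edge _
        (λ e ke → trans (cong (tgt G) (edgeOrigin-kept e ke)) (sym (origin-tgt e ke)))
        (λ w kw → trans (cong (tgt G) (edgeOrigin-new w kw)) (old-tgt w kw))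

      -- new edges replace distinct deleted edges, so no two edges of H share an origin
      edgeOriginD-injective : Injective _≡_ _≡_ edgeOriginD
      edgeOriginD-injective {inj₁ (e , ke)} {inj₁ (.e , ke′)} refl = cong (λ k → inj₁ (e , k)) (T-irrelevant ke ke′)
      edgeOriginD-injective {inj₁ (e , ke)} {inj₂ (w , kw)} eq = ⊥-elim (old-deleted w kw (subst KeptEdge eq ke))
      edgeOriginD-injective {inj₂ (w , kw)} {inj₁ (e , ke)} eq = ⊥-elim (old-deleted w kw (subst KeptEdge (sym eq) ke))
      edgeOriginD-injective {inj₂ (w , kw)} {inj₂ (w′ , kw′)} eq with old-injective w kw w′ kw′ eq
      ... | refl = cong (λ k → inj₂ (w , k)) (T-irrelevant kw kw′)

      edgeOrigin-injective : Injective _≡_ _≡_ edgeOrigin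
      edgeOrigin-injective eq = from-injective φE (edgeOriginD-injective eq)

      in-edges-reflected : ∀ x e → tgt G e ≡ origin x → ∃ λ e′ → tgt H e′ ≡ x
      in-edges-reflected x e te with delE? e
      ... | yes deleted = deleted-replaced e x (λ ke → toWitnessFalse ke deleted) te
      ... | no ¬deleted = keptEdge e (fromWitnessFalse ¬deleted) , origin-injective (trans (origin-tgt e _) te)

      embedding : Embedding H G
      embedding = record
        { node = origin ; edge = edgeOrigin ; edge-src = edgeOrigin-src ; edge-tgt = edgeOrigin-tgt
        ; node-injective = origin-injective ; edge-injective = edgeOrigin-injective
        ; in-edges-reflected = in-edges-reflected }

    embedding-deleting : (Fin (nE (R r)) → ⊥) → (∀ e → ¬ KeptEdge e → ¬ Kept (tgt G e)) → Embedding H G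
    embedding-deleting no-new-edges tgt-deleted =
      Replacing.embedding (λ w _ → ⊥-elim (no-new-edges w)) (λ w _ → ⊥-elim (no-new-edges w))
        (λ w _ → ⊥-elim (no-new-edges w)) (λ w _ → ⊥-elim (no-new-edges w)) (λ w _ → ⊥-elim (no-new-edges w))
        (λ e x ¬ke te → ⊥-elim (tgt-deleted e ¬ke (subst Kept (sym te) (origin-is-kept x))))

record ContractionShape (r : Rule) : Set where
  field
    edge : Fin (nE (L r))
    only-edge : ∀ u → u ≡ edge
    interface : Fin (kV r)
    interface-src : ∀ k → iLV r k ≡ src (L r) edge
    tgt-deleted : ∀ k → iLV r k ≢ tgt (L r) edge
    tgt-root : root (L r) (tgt (L r) edge) ≡ just true
    no-new-nodes : ∀ w → ∃ λ k → iRV r k ≡ w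
    no-new-edges : Fin (nE (R r)) → ⊥
    unlabelled : ∀ k → Klab r k ≡ nothing
    unrooted : ∀ k → Kroot r k ≡ nothing
    new-label : ∀ k → lab (R r) (iRV r k) ≡ just □
    new-root : ∀ k → root (R r) (iRV r k) ≡ just true

r₀-contraction : ContractionShape r₀
r₀-contraction = record
  { edge = zero ; only-edge = λ { zero → refl } ; interface = zero
  ; interface-src = λ _ → refl ; tgt-deleted = λ _ () ; tgt-root = refl
  ; no-new-nodes = λ { zero → zero , refl } ; no-new-edges = λ ()
  ; unlabelled = λ _ → refl ; unrooted = λ _ → refl ; new-label = λ _ → refl ; new-root = λ _ → refl }

-- r₁ differs from r₀ only in the label of the contracted node
r₁-contraction : ContractionShape r₁
r₁-contraction = record
  { edge = zero ; only-edge = λ { zero → refl } ; interface = zero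
  ; interface-src = λ _ → refl ; tgt-deleted = λ _ () ; tgt-root = refl
  ; no-new-nodes = λ { zero → zero , refl } ; no-new-edges = λ ()
  ; unlabelled = λ _ → refl ; unrooted = λ _ → refl ; new-label = λ _ → refl ; new-root = λ _ → refl }

module Contraction {r : Rule} (shape : ContractionShape r) {G H : Graph} (I : Invariant G)
                   (m : Match r G) (iso : Result.IsResult r G m H) where
  open ContractionShape shape
  open Step r m iso
  open Invariant I
  open NoNewNodes (λ w kw → toWitnessFalse kw (no-new-nodes w))

  p q : Fin (nV G)
  p = fV (g m) (src (L r) edge)
  q = fV (g m) (tgt (L r) edge)

  e₀ : Fin (nE G)
  e₀ = fE (g m) edge

  q≡ρ : q ≡ ρ
  q≡ρ = ρ-unique q (f-root (g m) _ true tgt-root)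

  q-deleted : ∀ v → Kept v → v ≢ q
  q-deleted v kv v≡q = toWitnessFalse kv (tgt (L r) edge , (λ (k , eq) → tgt-deleted k eq) , sym v≡q)

  p-kept : Kept p
  p-kept = subst (λ u → Kept (fV (g m) u)) (interface-src interface) (fromWitnessFalse (keptK interface))

  other-edges-kept : ∀ e → e ≢ e₀ → KeptEdge e
  other-edges-kept e e≢e₀ = fromWitnessFalse λ (u , _ , eq) → e≢e₀ (trans (sym eq) (cong (fE (g m)) (only-edge u)))

  classify : ∀ v kv → (v ≡ p × lab H (kept v kv) ≡ just □ × root H (kept v kv) ≡ just true)
                    ⊎ (v ≢ p × lab H (kept v kv) ≡ lab G v × root H (kept v kv) ≡ root G v)
  classify v kv with relabelled unlabelled unrooted v kv
  ... | inj₁ (k , gk , eq-lab , eq-root) =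
    inj₁ (trans (sym gk) (cong (fV (g m)) (interface-src k)) , trans eq-lab (new-label k) , trans eq-root (new-root k))
  ... | inj₂ (untouched , eq-lab , eq-root) =
    inj₂ ((λ v≡p → untouched interface (trans (cong (fV (g m)) (interface-src interface)) (sym v≡p))) , eq-lab , eq-root)

  ρ′ : Fin (nV H)
  ρ′ = kept p p-kept

  ρ′-root : root H ρ′ ≡ just true
  ρ′-root with classify p p-kept
  ... | inj₁ (_ , _ , rt) = rt
  ... | inj₂ (p≢p , _) = ⊥-elim (p≢p refl)

  ρ′-label : lab H ρ′ ≡ just □
  ρ′-label with classify p p-kept
  ... | inj₁ (_ , l , _) = l
  ... | inj₂ (p≢p , _) = ⊥-elim (p≢p refl)

  -- the old root q is deleted, so p is the only root left
  ρ′-unique : ∀ v kv → root H (kept v kv) ≡ just true → kept v kv ≡ ρ′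
  ρ′-unique v kv rt with classify v kv
  ... | inj₁ (v≡p , _) = kept-cong v≡p
  ... | inj₂ (_ , _ , eq) = ⊥-elim (q-deleted v kv (trans (ρ-unique v (trans (sym eq) rt)) (sym q≡ρ)))

  deleted-edge-tgt : ∀ e → ¬ KeptEdge e → ¬ Kept (tgt G e)
  deleted-edge-tgt e ¬ke k-tgt with deleted-edge e ¬ke
  ... | u , _ , eq = q-deleted (tgt G e) k-tgt
                       (trans (cong (tgt G) (trans (sym eq) (cong (fE (g m)) (only-edge u)))) (f-tgt (g m) edge))

  -- targets of kept descent edges stay valid: △-targets keep their label,
  -- p becomes the root, and the deleted old root q is not kept
  target-preserved : ∀ w kw → △OrRoot G ρ w → △OrRoot H ρ′ (kept w kw)
  target-preserved w kw next with classify w kw | next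
  ... | inj₁ (w≡p , _) | _ = inj₂ (kept-cong w≡p)
  ... | inj₂ (_ , l , _) | inj₁ w△ = inj₁ (trans l w△)
  ... | inj₂ _ | inj₂ w≡ρ = ⊥-elim (q-deleted w kw (trans w≡ρ (sym q≡ρ)))

  -- a △-node of H is a △-node v ≠ p of G, whose descent edge does not start at p
  descent′ : ∀ v kv → lab H (kept v kv) ≡ just △ →
             ∃ λ e → src H e ≡ kept v kv × △OrRoot H ρ′ (tgt H e) × rank (origin (tgt H e)) < rank (origin (kept v kv))
  descent′ v kv l with classify v kv
  ... | inj₁ (_ , l′ , _) = ⊥-elim (□≢△ (trans (sym l′) l))
  ... | inj₂ (v≢p , l′ , _) with descent v (trans (sym l′) l)
  ...   | e , se , next , lt =
    keptEdge e ke , keptEdge-src e ke kv se ,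
    subst (△OrRoot H ρ′) (sym (keptEdge-tgt e ke kw refl)) (target-preserved _ kw next) ,
    subst₂ _<_ (sym (cong rank (origin-tgt e ke))) (sym (cong rank (origin-kept v kv))) lt
    where
    ke : KeptEdge e
    ke = other-edges-kept e (λ e≡e₀ → v≢p (trans (sym se) (trans (cong (src G) e≡e₀) (f-src (g m) edge))))
    kw : Kept (tgt G e)
    kw = tgt-kept e ke

  R-total : TLRG (R r)
  R-total = R-lab , R-root
    where
    R-lab : ∀ w → Is-just (lab (R r) w)
    R-lab w with no-new-nodes w
    ... | k , refl = ≡just⇒Is-just (new-label k)
    R-root : ∀ w → Is-just (root (R r) w)
    R-root w with no-new-nodes w
    ... | k , refl = ≡just⇒Is-just (new-root k)

  invariant : Invariant H
  invariant = record
    { total = total-preserved unlabelled unrooted R-total total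
    ; ρ = ρ′ ; ρ-root = ρ′-root ; ρ-unique = every-node _ ρ′-unique ; ρ-label = ρ′-label
    ; arborescence = reflect-arborescence (embedding-deleting no-new-edges deleted-edge-tgt) arborescence
    ; rank = λ x → rank (origin x)
    ; descent = every-node _ descent′ }

-- Rule r₂ moves the root ρ = a along an edge a → c: the edge is replaced by
-- a fresh copy, a becomes an unrooted △ and c the root.  The invariant is
-- preserved with c as the new root; ranks are shifted so that c has rank 0.
module Shift {G H : Graph} (I : Invariant G) (m : Match r₂ G) (iso : Result.IsResult r₂ G m H) where
  open Step r₂ m iso
  open Invariant I
  open InvariantProperties I using (noLoop)

  no-new-nodes : ∀ w → False (inKV? w) → ⊥
  no-new-nodes zero ()
  no-new-nodes (suc zero) ()

  open NoNewNodes no-new-nodes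

  a c : Fin (nV G)
  a = fV (g m) zero
  c = fV (g m) (suc zero)

  e₀ : Fin (nE G)
  e₀ = fE (g m) zero

  a≡ρ : a ≡ ρ
  a≡ρ = ρ-unique a (f-root (g m) zero true refl)

  a≢c : a ≢ c
  a≢c a≡c = noLoop e₀ (trans (f-src (g m) zero) (trans a≡c (sym (f-tgt (g m) zero))))

  c-label : lab G c ≡ just □
  c-label = f-lab (g m) (suc zero) □ refl

  -- every node of L is an interface node, so no node is deleted
  all-kept : ∀ v → Kept v
  all-kept v = fromWitnessFalse {a? = delV? v} λ (u , u∉K , _) → u∉K (u , refl)

  other-edges-kept : ∀ e → e ≢ e₀ → KeptEdge e
  other-edges-kept e e≢e₀ = fromWitnessFalse λ { (zero , _ , eq) → e≢e₀ (sym eq) }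

  e₀-deleted : ¬ KeptEdge e₀
  e₀-deleted ke = toWitnessFalse ke (zero , (λ { (() , _) }) , refl)

  new : Fin (nE H)
  new = newEdge zero tt

  new-src : ∀ kw → src H (newEdge zero kw) ≡ kept a (all-kept a)
  new-src kw = trans (φ-src _) (kept-cong refl)

  new-tgt : ∀ kw → tgt H (newEdge zero kw) ≡ kept c (all-kept c)
  new-tgt kw = trans (φ-tgt _) (kept-cong refl)

  classify : ∀ v kv → (v ≡ a × lab H (kept v kv) ≡ just △ × root H (kept v kv) ≡ just false)
                    ⊎ (v ≡ c × lab H (kept v kv) ≡ just □ × root H (kept v kv) ≡ just true)
                    ⊎ (v ≢ a × v ≢ c × lab H (kept v kv) ≡ lab G v × root H (kept v kv) ≡ root G v)
  classify v kv with relabelled (λ _ → refl) (λ _ → refl) v kv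
  ... | inj₁ (zero , gk , eq-lab , eq-root) = inj₁ (sym gk , eq-lab , eq-root)
  ... | inj₁ (suc zero , gk , eq-lab , eq-root) = inj₂ (inj₁ (sym gk , eq-lab , eq-root))
  ... | inj₂ (untouched , eq-lab , eq-root) =
    inj₂ (inj₂ ((λ v≡a → untouched zero (sym v≡a)) , (λ v≡c → untouched (suc zero) (sym v≡c)) , eq-lab , eq-root))

  ρ′ : Fin (nV H)
  ρ′ = kept c (all-kept c)

  ρ′-root : root H ρ′ ≡ just true
  ρ′-root with classify c (all-kept c)
  ... | inj₁ (c≡a , _) = ⊥-elim (a≢c (sym c≡a))
  ... | inj₂ (inj₁ (_ , _ , rt)) = rt
  ... | inj₂ (inj₂ (_ , c≢c , _)) = ⊥-elim (c≢c refl)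

  ρ′-label : lab H ρ′ ≡ just □
  ρ′-label with classify c (all-kept c)
  ... | inj₁ (c≡a , _) = ⊥-elim (a≢c (sym c≡a))
  ... | inj₂ (inj₁ (_ , l , _)) = l
  ... | inj₂ (inj₂ (_ , c≢c , _)) = ⊥-elim (c≢c refl)

  -- the old root a lost its root mark, so c is the only root
  ρ′-unique : ∀ v kv → root H (kept v kv) ≡ just true → kept v kv ≡ ρ′
  ρ′-unique v kv rt with classify v kv
  ... | inj₁ (_ , _ , rt′) with trans (sym rt′) rt
  ...   | ()
  ρ′-unique v kv rt | inj₂ (inj₁ (v≡c , _)) = kept-cong v≡c
  ρ′-unique v kv rt | inj₂ (inj₂ (v≢a , _ , _ , eq)) = ⊥-elim (v≢a (trans (ρ-unique v (trans (sym eq) rt)) (sym a≡ρ)))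

  embedding′ : Embedding H G
  embedding′ = Replacing.embedding (λ _ _ → e₀)
    (λ { zero kw → trans (f-src (g m) zero) (sym (trans (cong origin (new-src kw)) (origin-kept _ _))) })
    (λ { zero kw → trans (f-tgt (g m) zero) (sym (trans (cong origin (new-tgt kw)) (origin-kept _ _))) })
    (λ _ _ → e₀-deleted)
    (λ { zero _ zero _ _ → refl })
    replaced
    where
    replaced : ∀ e x → ¬ KeptEdge e → tgt G e ≡ origin x → ∃ λ e′ → tgt H e′ ≡ x
    replaced e x ¬ke te with deleted-edge e ¬ke
    ... | zero , _ , refl = new , origin-injective (trans (cong origin (new-tgt tt))
                                   (trans (origin-kept _ _) (trans (sym (f-tgt (g m) zero)) te)))

  shifted : Fin (nV G) → ℕ
  shifted v with v ≟ᶠ c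
  ... | yes _ = 0
  ... | no _ = suc (rank v)

  shifted-c : shifted c ≡ 0
  shifted-c with c ≟ᶠ c
  ... | yes _ = refl
  ... | no c≢c = ⊥-elim (c≢c refl)

  shifted-other : ∀ v → v ≢ c → shifted v ≡ suc (rank v)
  shifted-other v v≢c with v ≟ᶠ c
  ... | yes v≡c = ⊥-elim (v≢c v≡c)
  ... | no _ = refl

  rank′ : Fin (nV H) → ℕ
  rank′ x = shifted (origin x)

  -- c is labelled □ and is not the old root, so no descent edge points to it
  target≢c : ∀ w → △OrRoot G ρ w → w ≢ c
  target≢c w (inj₁ w△) refl = □≢△ (trans (sym c-label) w△)
  target≢c w (inj₂ w≡ρ) w≡c = a≢c (trans a≡ρ (trans (sym w≡ρ) w≡c))

  target-preserved : ∀ w kw → △OrRoot G ρ w → △OrRoot H ρ′ (kept w kw)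
  target-preserved w kw next with classify w kw | next
  ... | inj₁ (_ , l , _) | _ = inj₁ l
  ... | inj₂ (inj₁ (w≡c , _)) | _ = ⊥-elim (target≢c w next w≡c)
  ... | inj₂ (inj₂ (_ , _ , l , _)) | inj₁ w△ = inj₁ (trans l w△)
  ... | inj₂ (inj₂ (w≢a , _)) | inj₂ w≡ρ = ⊥-elim (w≢a (trans w≡ρ (sym a≡ρ)))

  -- the old root descends along the fresh edge to c; other △-nodes keep their edge
  descent′ : ∀ v kv → lab H (kept v kv) ≡ just △ →
             ∃ λ e → src H e ≡ kept v kv × △OrRoot H ρ′ (tgt H e) × rank′ (tgt H e) < rank′ (kept v kv)
  descent′ v kv l with classify v kv
  ... | inj₁ (v≡a , _) =
    new , trans (new-src tt) (kept-cong (sym v≡a)) , inj₂ (new-tgt tt) ,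
    subst₂ _<_ (sym rank-c) (sym (trans (cong shifted (origin-kept v kv)) (shifted-other v v≢c))) (s≤s z≤n)
    where
    v≢c : v ≢ c
    v≢c v≡c = a≢c (trans (sym v≡a) v≡c)
    rank-c : rank′ (tgt H new) ≡ 0
    rank-c = trans (cong shifted (trans (cong origin (new-tgt tt)) (origin-kept _ _))) shifted-c
  ... | inj₂ (inj₁ (_ , l′ , _)) = ⊥-elim (□≢△ (trans (sym l′) l))
  ... | inj₂ (inj₂ (v≢a , v≢c , l′ , _)) with descent v (trans (sym l′) l)
  ...   | e , se , next , lt =
    keptEdge e ke , keptEdge-src e ke kv se ,
    subst (△OrRoot H ρ′) (sym (keptEdge-tgt e ke kw refl)) (target-preserved _ kw next) ,
    subst₂ _<_ (sym (trans (cong shifted (origin-tgt e ke)) (shifted-other _ (target≢c _ next))))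
               (sym (trans (cong shifted (origin-kept v kv)) (shifted-other v v≢c))) (s≤s lt)
    where
    ke : KeptEdge e
    ke = other-edges-kept e (λ e≡e₀ → v≢a (trans (sym se) (trans (cong (src G) e≡e₀) (f-src (g m) zero))))
    kw : Kept (tgt G e)
    kw = tgt-kept e ke

  R-total : TLRG (R r₂)
  R-total = (λ { zero → MaybeAny.just tt ; (suc zero) → MaybeAny.just tt }) ,
            (λ { zero → MaybeAny.just tt ; (suc zero) → MaybeAny.just tt })

  invariant : Invariant H
  invariant = record
    { total = total-preserved (λ _ → refl) (λ _ → refl) R-total total
    ; ρ = ρ′ ; ρ-root = ρ′-root ; ρ-unique = every-node _ ρ′-unique ; ρ-label = ρ′-label
    ; arborescence = reflect-arborescence embedding′ arborescence
    ; rank = rank′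
    ; descent = every-node _ descent′ }

-- Input trees satisfy the invariant; they contain no △-node yet.
inputTree⇒invariant : ∀ G → InputTree G → Invariant G
inputTree⇒invariant G (total , (ρ , ρ-root , ρ-unique) , all-□ , _ , tree) = record
  { total = total ; ρ = ρ ; ρ-root = ρ-root ; ρ-unique = ρ-unique ; ρ-label = all-□ ρ
  ; arborescence = inputTree⇒arborescence G tree
  ; rank = λ _ → 0
  ; descent = λ v v△ → ⊥-elim (□≢△ (trans (sym (all-□ v)) v△)) }

step-invariant : ∀ {G H} → Invariant G → G ⇒ H → Invariant H
step-invariant I (.r₀ , in-r₀ , _ , m , iso) = Contraction.invariant r₀-contraction I m iso
step-invariant I (.r₁ , in-r₁ , _ , m , iso) = Contraction.invariant r₁-contraction I m iso
step-invariant I (.r₂ , in-r₂ , _ , m , iso) = Shift.invariant I m iso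

derivation-invariant : ∀ {G H} → Invariant G → G ⇒* H → Invariant H
derivation-invariant I ε = I
derivation-invariant I (step ◅ steps) = derivation-invariant (step-invariant I step) steps

mainTheorem11 : (G H : Graph) → InputTree G → G ⇒* H →
                (nV H ≡ 1) ⊎ Σ Rule (λ r → InRules r × Applicable r H)
mainTheorem11 G H input derivation =
  NormalForm.normalForm (derivation-invariant (inputTree⇒invariant G input) derivation)
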